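{- Let $i, j, k$ be distinct integers in $\{1, \dots, r\}$ (with $r \geq 3$). For any $l \geq 1$, the graph $\mathcal{H}(V_i, V_j, V_k)$ does not contain a copy of $K_{2, 2l^2+1}$ whose part of size $2$ consists of one vertex in $V_i$ and one vertex in $V_j$ and whose part of size $2l^2+1$ is contained in $V_k$.
   Context: Let $q$ be a power of an odd prime, and let $r \geq 2$ and $l \geq 1$ be integers. Let $\alpha_1, \dots, \alpha_r$ be distinct elements of $\mathbb{F}_q$, and let $m_1, \dots, m_l$ be distinct elements of $\mathbb{F}_q^* = \mathbb{F}_q \setminus\{0\}$ such that $m_s(\alpha_k - \alpha_i) \neq m_t(\alpha_k - \alpha_j)$ whenever $1 \leq s, t \leq l$ and $i, j, k$ are distinct integers in $\{1, \dots, r\}$. For $1 \leq i \leq r$ let $V_i = \mathbb{F}_q \times \mathbb{F}_q \times \{i\}$. For $x, y \in \mathbb{F}_q$, $a \in \mathbb{F}_q^*$ and $s \in \{1, \dots, l\}$, let \[ e(x,y,a,m_s) = \{ (x + \alpha_i m_s a,\; y + \alpha_i m_s a^2,\; i) : 1 \leq i \leq r \}. \] $\mathcal{H}$ is the $r$-uniform hypergraph with vertex set $V_1 \cup \dots \cup V_r$ and edge set $\{ e(x,y,a,m_s) : x,y \in \mathbb{F}_q,\ a \in \mathbb{F}_q^*,\ 1 \leq s \leq l\}$. For $i \neq j$, $\mathcal{H}(V_i, V_j)$ is the bipartite graph with parts $V_i$ and $V_j$ in which $(u,v,i)$ and $(u',v',j)$ are adjacent iff some edge of $\mathcal{H}$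 contains both. For distinct $i,j,k$, $\mathcal{H}(V_i,V_j,V_k)$ is the union of the graphs $\mathcal{H}(V_i,V_j)$, $\mathcal{H}(V_j,V_k)$ and $\mathcal{H}(V_k,V_i)$. -}

module Defs where

open import Level using (0ℓ)
open import Data.Nat using (ℕ; _+_; _*_)
open import Data.Fin using (Fin)
open import Data.Product using (Σ; ∃; _×_; _,_)
open import Relation.Nullary using (¬_)
open import Relation.Binary.PropositionalEquality using (_≡_; _≢_)
open import Relation.Binary.Definitions using (DecidableEquality)
open import Algebra.Structures using (IsCommutativeRing)
open import Function.Bundles using (_↔_)
open import Function.Definitions using (Injective)

-- A finite field of odd characteristic (i.e. F_q with q a power of an odd
-- prime): a commutative ring (with propositional equality) with 0 ≠ 1, in
-- which every nonzero element is invertible, which is finite (in bijection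
-- with Fin q for some q), and in which 1 + 1 ≠ 0.
record OddFiniteField : Set₁ where
  infixl 6 _+F_ _-F_
  infixl 7 _*F_
  field
    F      : Set
    _+F_   : F → F → F
    _*F_   : F → F → F
    -F_    : F → F
    0F     : F
    1F     : F
    isCommutativeRing : IsCommutativeRing _≡_ _+F_ _*F_ -F_ 0F 1F
    0≢1    : 0F ≢ 1F
    inverse : ∀ x → x ≢ 0F → Σ F (λ y → x *F y ≡ 1F)
    _≟F_   : DecidableEquality F
    size   : ℕ
    finite : F ↔ Fin size
    oddChar : 1F +F 1F ≢ 0F

  _-F_ : F → F → F
  x -F y = x +F (-F y)

module Hypergraph (𝔽 : OddFiniteField) where
  open OddFiniteField 𝔽 public

  -- Vertex of V_i is (u , v , i); we represent the pair (u , v) ∈ F × F and keep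
  -- the part index i separately.

  -- Adjacency in H(V_i , V_j): (u,v,i) ~ (u',v',j) iff some edge
  -- e(x,y,a,m_s) contains both, i.e. there exist x, y, a ≠ 0, s with
  -- (u,v) = (x + α_i m_s a , y + α_i m_s a²) and
  -- (u',v') = (x + α_j m_s a , y + α_j m_s a²).
  Adj : ∀ {r l} (α : Fin r → F) (m : Fin l → F) (i j : Fin r) →
        F × F → F × F → Set
  Adj {l = l} α m i j (u , v) (u' , v') =
    ∃ λ (x : F) → ∃ λ (y : F) → ∃ λ (a : F) → ∃ λ (s : Fin l) →
      (a ≢ 0F) ×
      (u  ≡ x +F α i *F m s *F a) × (v  ≡ y +F α i *F m s *F (a *F a)) ×
      (u' ≡ x +F α j *F m s *F a) × (v' ≡ y +F α j *F m s *F (a *F a))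

  -- H(V_i,V_j,V_k) contains a copy of K_{2,t} whose 2-part is one vertex p of V_i
  -- and one vertex p' of V_j, and whose t-part is t distinct vertices of V_k.
  -- (Edges between V_i and V_k are those of H(V_k,V_i) = H(V_i,V_k), etc.)
  HasK2t : ∀ {r l} (α : Fin r → F) (m : Fin l → F) (i j k : Fin r) (t : ℕ) → Set
  HasK2t α m i j k t =
    ∃ λ (p : F × F) → ∃ λ (p' : F × F) → ∃ λ (w : Fin t → F × F) →
      Injective _≡_ _≡_ w ×
      (∀ n → Adj α m i k p (w n) × Adj α m j k p' (w n))

-- A neighbour (U, V) ∈ V_k of p = (u, v) ∈ V_i along an edge of slope m_s lies
-- on the parabola (U - u)² = c (V - v) with c = m_s (α_k - α_i).  So each
-- common neighbour of p and p′ lies on one of l parabolas with apex p and on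
-- one of l parabolas with apex p′, and by hypothesis every parameter c of the
-- first family differs from every parameter d of the second.  Two parabolas
-- with c ≠ 0, c ≠ d meet in at most two points: distinct common points have
-- distinct abscissae U, U′ whose sum σ depends only on c, d, p, p′, so a common
-- point is determined by one bit saying whether U precedes σ - U in a fixed
-- enumeration of F.  Hence there are at most 2 l² common neighbours.

module Submission where

open import Defs
open import Data.Nat using (ℕ; _+_; _*_; _≥_)
open import Data.Fin using (Fin)
open import Data.Product using (_×_)
open import Relation.Nullary using (¬_)
open import Relation.Binary.PropositionalEquality using (_≡_; _≢_)
open import Function.Definitions using (Injective)

open import Level using (0ℓ)
open import Data.Empty using (⊥-elim)
open import Data.Fin using (zero; suc; toℕ; combine)
open import Data.Fin.Properties using (toℕ-injective; combine-injective; injective⇒≤)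
open import Data.Maybe using (Maybe; just; nothing)
open import Data.Product using (Σ; _,_; proj₁; proj₂)
open import Data.Sign using (Sign)
open import Data.Sum using (inj₁; inj₂)
open import Relation.Nullary using (yes; no)
open import Relation.Binary.PropositionalEquality using (refl; sym; trans; cong; cong₂; subst; module ≡-Reasoning)
open import Algebra.Bundles using (CommutativeRing)
open import Algebra.Solver.Ring.AlmostCommutativeRing using (fromCommutativeRing; _-Raw-AlmostCommutative⟶_)
open import Function.Bundles using (Injection)
open import Function.Properties.Inverse using (↔⇒↣)
import Data.Nat as ℕ
import Data.Nat.Properties as ℕ
import Data.Integer as ℤ
import Data.Integer.Properties as ℤ
import Data.Sign as Sign
import Relation.Binary.PropositionalEquality as ≡

module IntegerCoefficientSolver {a ℓ} (R : CommutativeRing a ℓ) where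
  open CommutativeRing R
    renaming (_+_ to _+ᴿ_; _*_ to _*ᴿ_; -_ to -ᴿ_; refl to ≈-refl; sym to ≈-sym; trans to ≈-trans)
  open import Algebra.Properties.Ring ring using (-‿distribˡ-*; -‿distribʳ-*)
  open import Algebra.Properties.AbelianGroup +-abelianGroup using (⁻¹-∙-comm; ε⁻¹≈ε; ⁻¹-involutive)
  open import Algebra.Properties.CommutativeSemigroup +-commutativeSemigroup using (interchange)
  open import Algebra.Properties.Semiring.Mult semiring using (×-homo-+; ×1-homo-*) renaming (_×_ to _·_)
  open import Relation.Binary.Reasoning.Setoid setoid

  applySign : Sign → Carrier → Carrier
  applySign Sign.+ x = x
  applySign Sign.- x = -ᴿ x

  fromℤ : ℤ.ℤ → Carrier
  fromℤ i = applySign (ℤ.sign i) (ℤ.∣ i ∣ · 1#)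

  -- ℤ's multiplication is defined through s ◃ n (sign times magnitude); its
  -- image is the signed image of n, also for the zero of either sign.
  fromℤ-◃ : ∀ s n → fromℤ (s ℤ.◃ n) ≈ applySign s (n · 1#)
  fromℤ-◃ Sign.+ ℕ.zero    = ≈-refl
  fromℤ-◃ Sign.- ℕ.zero    = ≈-sym ε⁻¹≈ε
  fromℤ-◃ Sign.+ (ℕ.suc n) = ≈-refl
  fromℤ-◃ Sign.- (ℕ.suc n) = ≈-refl

  applySign-* : ∀ s t x y → applySign (s Sign.* t) (x *ᴿ y) ≈ applySign s x *ᴿ applySign t y
  applySign-* Sign.+ Sign.+ x y = ≈-refl
  applySign-* Sign.+ Sign.- x y = -‿distribʳ-* x y
  applySign-* Sign.- Sign.+ x y = -‿distribˡ-* x y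
  applySign-* Sign.- Sign.- x y = begin
    x *ᴿ y                 ≈⟨ ⁻¹-involutive _ ⟨
    -ᴿ (-ᴿ (x *ᴿ y))       ≈⟨ -‿cong (-‿distribˡ-* x y) ⟩
    -ᴿ ((-ᴿ x) *ᴿ y)       ≈⟨ -‿distribʳ-* _ _ ⟩
    (-ᴿ x) *ᴿ (-ᴿ y)       ∎

  fromℤ-homo-* : ∀ i j → fromℤ (i ℤ.* j) ≈ fromℤ i *ᴿ fromℤ j
  fromℤ-homo-* i j = begin
    fromℤ ((s Sign.* t) ℤ.◃ (m ℕ.* n))               ≈⟨ fromℤ-◃ (s Sign.* t) (m ℕ.* n) ⟩
    applySign (s Sign.* t) ((m ℕ.* n) · 1#)         ≈⟨ applySign-cong (s Sign.* t) (×1-homo-* m n) ⟩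
    applySign (s Sign.* t) ((m · 1#) *ᴿ (n · 1#))   ≈⟨ applySign-* s t _ _ ⟩
    fromℤ i *ᴿ fromℤ j                              ∎
    where
    s t : Sign
    s = ℤ.sign i
    t = ℤ.sign j
    m n : ℕ
    m = ℤ.∣ i ∣
    n = ℤ.∣ j ∣
    applySign-cong : ∀ s {x y} → x ≈ y → applySign s x ≈ applySign s y
    applySign-cong Sign.+ x≈y = x≈y
    applySign-cong Sign.- x≈y = -‿cong x≈y

  fromℤ-⊖ : ∀ m n → fromℤ (m ℤ.⊖ n) ≈ (m · 1#) +ᴿ -ᴿ (n · 1#)
  fromℤ-⊖ m       ℕ.zero    = ≈-sym (≈-trans (+-congˡ ε⁻¹≈ε) (+-identityʳ _))
  fromℤ-⊖ ℕ.zero  (ℕ.suc n) = ≈-sym (+-identityˡ _)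
  fromℤ-⊖ (ℕ.suc m) (ℕ.suc n) = begin
    fromℤ (ℕ.suc m ℤ.⊖ ℕ.suc n)      ≡⟨ ≡.cong fromℤ (ℤ.[1+m]⊖[1+n]≡m⊖n m n) ⟩
    fromℤ (m ℤ.⊖ n)                  ≈⟨ fromℤ-⊖ m n ⟩
    x +ᴿ -ᴿ y                        ≈⟨ +-identityˡ _ ⟨
    0# +ᴿ (x +ᴿ -ᴿ y)                ≈⟨ +-congʳ (-‿inverseʳ 1#) ⟨
    (1# +ᴿ -ᴿ 1#) +ᴿ (x +ᴿ -ᴿ y)     ≈⟨ interchange _ _ _ _ ⟩
    (1# +ᴿ x) +ᴿ (-ᴿ 1# +ᴿ -ᴿ y)     ≈⟨ +-congˡ (⁻¹-∙-comm 1# y) ⟩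
    (1# +ᴿ x) +ᴿ -ᴿ (1# +ᴿ y)        ∎
    where
    x y : Carrier
    x = m · 1#
    y = n · 1#

  fromℤ-homo-+ : ∀ i j → fromℤ (i ℤ.+ j) ≈ fromℤ i +ᴿ fromℤ j
  fromℤ-homo-+ (ℤ.+ m)    (ℤ.+ n)    = ×-homo-+ 1# m n
  fromℤ-homo-+ (ℤ.+ m)    ℤ.-[1+ n ] = fromℤ-⊖ m (ℕ.suc n)
  fromℤ-homo-+ ℤ.-[1+ m ] (ℤ.+ n)    = ≈-trans (fromℤ-⊖ n (ℕ.suc m)) (+-comm _ _)
  fromℤ-homo-+ ℤ.-[1+ m ] ℤ.-[1+ n ] = begin
    -ᴿ (ℕ.suc (ℕ.suc (m ℕ.+ n)) · 1#)         ≡⟨ ≡.cong (λ k → -ᴿ (ℕ.suc k · 1#)) (ℕ.+-suc m n) ⟨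
    -ᴿ ((ℕ.suc m ℕ.+ ℕ.suc n) · 1#)           ≈⟨ -‿cong (×-homo-+ 1# (ℕ.suc m) (ℕ.suc n)) ⟩
    -ᴿ ((ℕ.suc m · 1#) +ᴿ (ℕ.suc n · 1#))     ≈⟨ ⁻¹-∙-comm _ _ ⟨
    -ᴿ (ℕ.suc m · 1#) +ᴿ -ᴿ (ℕ.suc n · 1#)    ∎

  fromℤ-homo-neg : ∀ i → fromℤ (ℤ.- i) ≈ -ᴿ fromℤ i
  fromℤ-homo-neg ℤ.-[1+ n ]       = ≈-sym (⁻¹-involutive _)
  fromℤ-homo-neg (ℤ.+ ℕ.zero)     = ≈-sym ε⁻¹≈ε
  fromℤ-homo-neg (ℤ.+ (ℕ.suc n))  = ≈-refl

  integerHomomorphism : ℤ.+-*-rawRing -Raw-AlmostCommutative⟶ fromCommutativeRing R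
  integerHomomorphism = record
    { ⟦_⟧ = fromℤ ; +-homo = fromℤ-homo-+ ; *-homo = fromℤ-homo-* ; -‿homo = fromℤ-homo-neg
    ; 0-homo = ≈-refl ; 1-homo = +-identityʳ 1# }

  -- The solver compares coefficients syntactically; equal integers have
  -- equal images.
  coefficient≟ : ∀ i j → Maybe (fromℤ i ≈ fromℤ j)
  coefficient≟ i j with i ℤ.≟ j
  ... | yes i≡j = just (reflexive (≡.cong fromℤ i≡j))
  ... | no _    = nothing

  open import Algebra.Solver.Ring ℤ.+-*-rawRing (fromCommutativeRing R) integerHomomorphism coefficient≟ public

module FieldLemmas (𝔽 : OddFiniteField) where
  open OddFiniteField 𝔽

  commutativeRing : CommutativeRing 0ℓ 0ℓ
  commutativeRing = record { isCommutativeRing = isCommutativeRing }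

  open CommutativeRing commutativeRing using (+-identityˡ; *-identityˡ; zeroʳ)
  open IntegerCoefficientSolver commutativeRing public using (solve; _:+_; _:-_; _:*_; _:=_)
  open ≡-Reasoning

  twice : F → F
  twice x = x +F x

  -- A total inverse, with 0 ⁻¹ = 0, so that formulas involving quotients can be
  -- written down before their denominators are known to be nonzero.
  _⁻¹ : F → F
  x ⁻¹ with x ≟F 0F
  ... | yes _    = 0F
  ... | no x≢0   = proj₁ (inverse x x≢0)

  *-inverseʳ : ∀ {x} → x ≢ 0F → x *F x ⁻¹ ≡ 1F
  *-inverseʳ {x} x≢0 with x ≟F 0F
  ... | yes x≡0  = ⊥-elim (x≢0 x≡0)
  ... | no x≢0′  = proj₂ (inverse x x≢0′)

  *-cancelˡ : ∀ {a x y} → a ≢ 0F → a *F x ≡ a *F y → x ≡ y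
  *-cancelˡ {a} {x} {y} a≢0 ax≡ay = begin
    x                     ≡⟨ sym (*-identityˡ x) ⟩
    1F *F x               ≡⟨ cong (_*F x) (sym (*-inverseʳ a≢0)) ⟩
    (a *F a ⁻¹) *F x      ≡⟨ solve 3 (λ a b x → (a :* b) :* x := b :* (a :* x)) refl a (a ⁻¹) x ⟩
    a ⁻¹ *F (a *F x)      ≡⟨ cong (a ⁻¹ *F_) ax≡ay ⟩
    a ⁻¹ *F (a *F y)      ≡⟨ solve 3 (λ a b y → b :* (a :* y) := (a :* b) :* y) refl a (a ⁻¹) y ⟩
    (a *F a ⁻¹) *F y      ≡⟨ cong (_*F y) (*-inverseʳ a≢0) ⟩
    1F *F y               ≡⟨ *-identityˡ y ⟩
    y                     ∎

  *-nonzero : ∀ {a b} → a ≢ 0F → b ≢ 0F → a *F b ≢ 0F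
  *-nonzero {a} {b} a≢0 b≢0 ab≡0 = b≢0 (*-cancelˡ a≢0 (trans ab≡0 (sym (zeroʳ a))))

  x-y≡0⇒x≡y : ∀ {x y} → x -F y ≡ 0F → x ≡ y
  x-y≡0⇒x≡y {x} {y} x-y≡0 = begin
    x               ≡⟨ solve 2 (λ x y → x := (x :- y) :+ y) refl x y ⟩
    (x -F y) +F y   ≡⟨ cong (_+F y) x-y≡0 ⟩
    0F +F y         ≡⟨ +-identityˡ y ⟩
    y               ∎

  x≢y⇒x-y≢0 : ∀ {x y} → x ≢ y → x -F y ≢ 0F
  x≢y⇒x-y≢0 x≢y x-y≡0 = x≢y (x-y≡0⇒x≡y x-y≡0)

  x+y≡s⇒s-x≡y : ∀ {x y s} → x +F y ≡ s → s -F x ≡ y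
  x+y≡s⇒s-x≡y {x} {y} {s} x+y≡s = begin
    s -F x           ≡⟨ cong (_-F x) (sym x+y≡s) ⟩
    (x +F y) -F x    ≡⟨ solve 2 (λ x y → (x :+ y) :- x := y) refl x y ⟩
    y                ∎

module TieBreak {A : Set} (index : A → ℕ) (index-injective : Injective _≡_ _≡_ index) where

  precedes : A → A → Fin 2
  precedes a b with index a ℕ.≤? index b
  ... | yes _ = zero
  ... | no _  = suc zero

  precedes-swap : ∀ {a b} → a ≢ b → precedes a b ≢ precedes b a
  precedes-swap {a} {b} a≢b with index a ℕ.≤? index b | index b ℕ.≤? index a
  ... | yes a≤b | yes b≤a = λ _ → a≢b (index-injective (ℕ.≤-antisym a≤b b≤a))
  ... | yes _   | no _    = λ ()
  ... | no _    | yes _   = λ ()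
  ... | no a≰b  | no b≰a  with ℕ.≤-total (index a) (index b)
  ...   | inj₁ a≤b = λ _ → a≰b a≤b
  ...   | inj₂ b≤a = λ _ → b≰a b≤a

module Parabolas (𝔽 : OddFiniteField) where
  open Hypergraph 𝔽
  open FieldLemmas 𝔽
  open CommutativeRing commutativeRing using (+-comm; *-identityˡ)
  open ≡-Reasoning

  OnParabola : F → F × F → F × F → Set
  OnParabola c (u , v) (U , V) = (U -F u) *F (U -F u) ≡ c *F (V -F v)

  adjacent⇒onParabola : ∀ {r l} (α : Fin r → F) (m : Fin l → F) (i k : Fin r) {p w : F × F} →
    Adj α m i k p w → Σ (Fin l) λ s → OnParabola (m s *F (α k -F α i)) p w
  adjacent⇒onParabola α m i k (x , y , a , s , _ , refl , refl , refl , refl) =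
    s , solve 6 (λ x y a αi αk ms →
          ((x :+ αk :* ms :* a) :- (x :+ αi :* ms :* a)) :* ((x :+ αk :* ms :* a) :- (x :+ αi :* ms :* a))
          := (ms :* (αk :- αi)) :* ((y :+ αk :* ms :* (a :* a)) :- (y :+ αi :* ms :* (a :* a))))
          refl x y a (α i) (α k) (m s)

  chord : ∀ {c u v U V U′ V′} → OnParabola c (u , v) (U , V) → OnParabola c (u , v) (U′ , V′) →
          (U -F U′) *F ((U +F U′) -F twice u) ≡ c *F (V -F V′)
  chord {c} {u} {v} {U} {V} {U′} {V′} on on′ = begin
    (U -F U′) *F ((U +F U′) -F twice u)
      ≡⟨ solve 3 (λ U U′ u → (U :- U′) :* ((U :+ U′) :- (u :+ u))
                           := ((U :- u) :* (U :- u)) :- ((U′ :- u) :* (U′ :- u))) refl U U′ u ⟩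
    ((U -F u) *F (U -F u)) -F ((U′ -F u) *F (U′ -F u))   ≡⟨ cong₂ _-F_ on on′ ⟩
    (c *F (V -F v)) -F (c *F (V′ -F v))
      ≡⟨ solve 4 (λ c V V′ v → (c :* (V :- v)) :- (c :* (V′ :- v)) := c :* (V :- V′)) refl c V V′ v ⟩
    c *F (V -F V′)                                        ∎

  sameAbscissa : ∀ {c p U V V′} → c ≢ 0F → OnParabola c p (U , V) → OnParabola c p (U , V′) → V ≡ V′
  sameAbscissa {c} {u , v} {U} {V} {V′} c≢0 on on′ = begin
    V               ≡⟨ solve 2 (λ V v → V := (V :- v) :+ v) refl V v ⟩
    (V -F v) +F v   ≡⟨ cong (_+F v) (*-cancelˡ c≢0 (trans (sym on) on′)) ⟩
    (V′ -F v) +F v  ≡⟨ solve 2 (λ V v → (V :- v) :+ v := V) refl V′ v ⟩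
    V′              ∎

  -- The common value of U + U′ for two common points with U ≠ U′ of the
  -- parabolas with parameters c, d and apex abscissae u, u′.
  abscissaSum : F → F → F → F → F
  abscissaSum c d u u′ = (d -F c) ⁻¹ *F twice (d *F u -F c *F u′)

  -- Dividing the two
  -- chord equations by each other eliminates V - V′, leaving a linear equation
  -- for U + U′.
  commonChord : ∀ {c d u v u′ v′ U V U′ V′} → c ≢ d → U ≢ U′ →
    OnParabola c (u , v) (U , V) → OnParabola c (u , v) (U′ , V′) →
    OnParabola d (u′ , v′) (U , V) → OnParabola d (u′ , v′) (U′ , V′) →
    U +F U′ ≡ abscissaSum c d u u′
  commonChord {c} {d} {u} {v} {u′} {v′} {U} {V} {U′} {V′} c≢d U≢U′ on₁ on₁′ on₂ on₂′ =
    *-cancelˡ d-c≢0 (trans linear (sym (*-inverse-cancel (twice (d *F u -F c *F u′)))))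
    where
    S : F
    S = U +F U′
    d-c≢0 : d -F c ≢ 0F
    d-c≢0 = x≢y⇒x-y≢0 (λ d≡c → c≢d (sym d≡c))

    weighted : d *F (S -F twice u) ≡ c *F (S -F twice u′)
    weighted = *-cancelˡ (x≢y⇒x-y≢0 U≢U′) (begin
      (U -F U′) *F (d *F (S -F twice u))
        ≡⟨ solve 3 (λ D d X → D :* (d :* X) := d :* (D :* X)) refl (U -F U′) d (S -F twice u) ⟩
      d *F ((U -F U′) *F (S -F twice u))   ≡⟨ cong (d *F_) (chord on₁ on₁′) ⟩
      d *F (c *F (V -F V′))
        ≡⟨ solve 3 (λ d c X → d :* (c :* X) := c :* (d :* X)) refl d c (V -F V′) ⟩
      c *F (d *F (V -F V′))                ≡⟨ cong (c *F_) (sym (chord on₂ on₂′)) ⟩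
      c *F ((U -F U′) *F (S -F twice u′))
        ≡⟨ solve 3 (λ D c X → c :* (D :* X) := D :* (c :* X)) refl (U -F U′) c (S -F twice u′) ⟩
      (U -F U′) *F (c *F (S -F twice u′))  ∎)

    linear : (d -F c) *F S ≡ twice (d *F u -F c *F u′)
    linear = begin
      (d -F c) *F S
        ≡⟨ solve 6 (λ d c U U′ u u′ → (d :- c) :* (U :+ U′)
             := ((d :* ((U :+ U′) :- (u :+ u))) :- (c :* ((U :+ U′) :- (u′ :+ u′))))
                :+ ((d :* u :- c :* u′) :+ (d :* u :- c :* u′))) refl d c U U′ u u′ ⟩
      (d *F (S -F twice u) -F c *F (S -F twice u′)) +F twice (d *F u -F c *F u′)
        ≡⟨ cong (λ z → (z -F c *F (S -F twice u′)) +F twice (d *F u -F c *F u′)) weighted ⟩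
      (c *F (S -F twice u′) -F c *F (S -F twice u′)) +F twice (d *F u -F c *F u′)
        ≡⟨ solve 2 (λ X K → (X :- X) :+ K := K) refl (c *F (S -F twice u′)) (twice (d *F u -F c *F u′)) ⟩
      twice (d *F u -F c *F u′)            ∎

    *-inverse-cancel : ∀ K → (d -F c) *F ((d -F c) ⁻¹ *F K) ≡ K
    *-inverse-cancel K = begin
      (d -F c) *F ((d -F c) ⁻¹ *F K)       ≡⟨ solve 3 (λ a b K → a :* (b :* K) := (a :* b) :* K) refl (d -F c) ((d -F c) ⁻¹) K ⟩
      ((d -F c) *F (d -F c) ⁻¹) *F K       ≡⟨ cong (_*F K) (*-inverseʳ d-c≢0) ⟩
      1F *F K                              ≡⟨ *-identityˡ K ⟩
      K                                    ∎

  open TieBreak (λ x → toℕ (Injection.to (↔⇒↣ finite) x))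
                (λ index≡ → Injection.injective (↔⇒↣ finite) (toℕ-injective index≡))

  -- The bit attached to a point (U , V): whether U comes before its partner
  -- abscissa abscissaSum c d u u′ - U.
  side : F → F → F → F → F × F → Fin 2
  side c d u u′ (U , V) = precedes U (abscissaSum c d u u′ -F U)

  -- Distinct common points have
  -- distinct abscissae U, U′ which are each other's partners, so their sides
  -- differ.
  side-injective : ∀ {c d u v u′ v′ w w′} → c ≢ 0F → c ≢ d →
    OnParabola c (u , v) w → OnParabola c (u , v) w′ →
    OnParabola d (u′ , v′) w → OnParabola d (u′ , v′) w′ →
    side c d u u′ w ≡ side c d u u′ w′ → w ≡ w′
  side-injective {c} {d} {u} {v} {u′} {v′} {U , V} {U′ , V′} c≢0 c≢d on₁ on₁′ on₂ on₂′ sides≡ with U ≟F U′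
  ... | yes refl  = cong (U ,_) (sameAbscissa c≢0 on₁ on₁′)
  ... | no U≢U′   = ⊥-elim (precedes-swap U≢U′ (begin
      precedes U U′             ≡⟨ cong (precedes U) (sym (x+y≡s⇒s-x≡y U+U′≡σ)) ⟩
      side c d u u′ (U , V)     ≡⟨ sides≡ ⟩
      side c d u u′ (U′ , V′)   ≡⟨ cong (precedes U′) (x+y≡s⇒s-x≡y (trans (+-comm U′ U) U+U′≡σ)) ⟩
      precedes U′ U             ∎))
    where
    U+U′≡σ : U +F U′ ≡ abscissaSum c d u u′
    U+U′≡σ = commonChord c≢d U≢U′ on₁ on₁′ on₂ on₂′

  -- Points lying both on a parabola of a family with apex p and on one of a
  -- family with apex p′ (l parabolas each, c s ≠ 0 and c s ≠ d t): there are
  -- at most 2 l² of them, since a point is encoded injectively by its two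
  -- parabolas and its side on them.
  commonPoints-bound : ∀ {l T} (c d : Fin l → F) (p p′ : F × F) →
    (∀ s → c s ≢ 0F) → (∀ s t → c s ≢ d t) →
    (w : Fin T → F × F) → Injective _≡_ _≡_ w →
    (∀ n → Σ (Fin l) λ s → OnParabola (c s) p (w n)) →
    (∀ n → Σ (Fin l) λ t → OnParabola (d t) p′ (w n)) →
    T ℕ.≤ 2 * (l * l)
  commonPoints-bound {l} {T} c d (u , v) (u′ , v′) c≢0 c≢d w w-injective onFirst onSecond =
    injective⇒≤ code-injective
    where
    s t : Fin T → Fin l
    s n = proj₁ (onFirst n)
    t n = proj₁ (onSecond n)

    code : Fin T → Fin (2 * (l * l))
    code n = combine (side (c (s n)) (d (t n)) u u′ (w n)) (combine (s n) (t n))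

    code-injective : Injective _≡_ _≡_ code
    code-injective {a} {b} codes≡ with combine-injective _ _ _ _ codes≡
    ... | sides≡ , parabolas≡ with combine-injective _ _ _ _ parabolas≡
    ... | s≡ , t≡ = w-injective (side-injective (c≢0 (s a)) (c≢d (s a) (t a))
          (proj₂ (onFirst a)) (subst (λ σ → OnParabola (c σ) (u , v) (w b)) (sym s≡) (proj₂ (onFirst b)))
          (proj₂ (onSecond a)) (subst (λ τ → OnParabola (d τ) (u′ , v′) (w b)) (sym t≡) (proj₂ (onSecond b)))
          (trans sides≡ (cong₂ (λ σ τ → side (c σ) (d τ) u u′ (w b)) (sym s≡) (sym t≡))))

-- The common neighbours of p and p′ are common points of two families of l
-- parabolas satisfying the hypotheses of commonPoints-bound, so there are at
-- most 2 l² of them.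
lemma3p9 : (𝔽 : OddFiniteField) → let open Hypergraph 𝔽 in
    (r l : ℕ) → r ≥ 2 → l ≥ 1 →
    (α : Fin r → F) → Injective _≡_ _≡_ α →
    (m : Fin l → F) → Injective _≡_ _≡_ m → (∀ s → m s ≢ 0F) →
    (∀ (s t : Fin l) (i j k : Fin r) → i ≢ j → j ≢ k → i ≢ k →
       m s *F (α k -F α i) ≢ m t *F (α k -F α j)) →
    (i j k : Fin r) → i ≢ j → j ≢ k → i ≢ k →
    ¬ HasK2t α m i j k (2 * (l * l) + 1)
lemma3p9 𝔽 r l _ _ α α-injective m _ m≢0 parameters-differ i j k i≢j j≢k i≢k
         (p , p′ , w , w-injective , adjacent) =
  ℕ.≤⇒≯ (commonPoints-bound c d p p′ c≢0 (λ s t → parameters-differ s t i j k i≢j j≢k i≢k)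
                             w w-injective onFirst onSecond)
        (ℕ.m<m+n (2 * (l * l)) (ℕ.s≤s ℕ.z≤n))
  where
  open Hypergraph 𝔽
  open FieldLemmas 𝔽
  open Parabolas 𝔽

  c d : Fin l → F
  c s = m s *F (α k -F α i)
  d t = m t *F (α k -F α j)

  c≢0 : ∀ s → c s ≢ 0F
  c≢0 s = *-nonzero (m≢0 s) (x≢y⇒x-y≢0 (λ αk≡αi → i≢k (sym (α-injective αk≡αi))))

  onFirst : ∀ n → Σ (Fin l) λ s → OnParabola (c s) p (w n)
  onFirst n = adjacent⇒onParabola α m i k (proj₁ (adjacent n))

  onSecond : ∀ n → Σ (Fin l) λ t → OnParabola (d t) p′ (w n)
  onSecond n = adjacent⇒onParabola α m j k (proj₂ (adjacent n))
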